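{- Let $G=(V,E)$ be a hypergraph and $e\in E$. Then \[ I(G,x)=\sum_{\emptyset\neq W\subseteq e}(-1)^{|W|+1}\cdot I(G_{ -W},x). \]
   Context: A hypergraph $G=(V,E)$ consists of a finite vertex set $V$ and a finite multiset $E$ of non-empty subsets of $V$ (edges). A set $W\subseteq V$ is independent in $G$ if no edge $f\in E$ satisfies $f\subseteq W$; the independence polynomial is $I(G,x)=\sum_{W\subseteq V,\ W\text{ independent}}x^{|W|}$. $G_{ -W}$ is obtained by deleting the vertices of $W$ together with all edges containing at least one of them. -}

module Defs where

open import Data.Nat using (ℕ; zero; suc)
open import Data.Integer using (ℤ; +_; -_; _*_; _+_; 0ℤ)
open import Data.Bool using (Bool)
open import Data.Vec using (_∷_; [])
open import Data.List using (List; []; _∷_; map; filter; length; foldr; _++_)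
open import Data.List.Relation.Unary.Any using (Any; any?)
open import Data.List.Relation.Unary.All using (All)
open import Data.Fin.Subset using (Subset; Side; inside; outside; _⊆_; _∩_; _─_; Nonempty; ∣_∣)
open import Data.Fin.Subset.Properties using (_⊆?_; nonempty?)
open import Data.Product using (_×_)
open import Relation.Nullary using (¬_)
open import Relation.Nullary.Decidable using (¬?; _×-dec_)
open import Relation.Binary.PropositionalEquality using (_≡_)
import Data.Nat.Properties as ℕP

record Hypergraph (n : ℕ) : Set where
  constructor hypergraph
  field
    V : Subset n
    E : List (Subset n)
open Hypergraph public

WellFormed : ∀ {n} → Hypergraph n → Set
WellFormed G = All (λ f → Nonempty f × f ⊆ V G) (E G)

allSubsets : (n : ℕ) → List (Subset n)
allSubsets zero = [] ∷ []
allSubsets (suc n) = map (outside ∷_) (allSubsets n) ++ map (inside ∷_) (allSubsets n)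

Independent : ∀ {n} → Hypergraph n → Subset n → Set
Independent G W = W ⊆ V G × ¬ Any (λ f → f ⊆ W) (E G)

independent? : ∀ {n} (G : Hypergraph n) (W : Subset n) → Relation.Nullary.Dec (Independent G W)
independent? G W = (W ⊆? V G) ×-dec ¬? (any? (λ f → f ⊆? W) (E G))

deleteVertices : ∀ {n} → Hypergraph n → Subset n → Hypergraph n
deleteVertices G W = hypergraph (V G ─ W) (filter (λ f → ¬? (nonempty? (f ∩ W))) (E G))

Poly : Set
Poly = ℕ → ℤ

_≈ₚ_ : Poly → Poly → Set
p ≈ₚ q = ∀ k → p k ≡ q k

0ₚ : Poly
0ₚ _ = 0ℤ

_+ₚ_ : Poly → Poly → Poly
(p +ₚ q) k = p k + q k

_·ₚ_ : ℤ → Poly → Poly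
(c ·ₚ p) k = c * p k

indepPoly : ∀ {n} → Hypergraph n → Poly
indepPoly {n} G k =
  + length (filter (λ W → independent? G W ×-dec (∣ W ∣ ℕP.≟ k)) (allSubsets n))

signPow : ℕ → ℤ
signPow zero = + 1
signPow (suc m) = - signPow m

inclExclSum : ∀ {n} → Hypergraph n → Subset n → Poly
inclExclSum {n} G e =
  foldr (λ W acc → (signPow (suc ∣ W ∣) ·ₚ indepPoly (deleteVertices G W)) +ₚ acc) 0ₚ
    (filter (λ W → nonempty? W ×-dec (W ⊆? e)) (allSubsets n))

-- Compare coefficients of x^k by summing over candidate sets U.  A set that is
-- independent in G₋W is independent in G, and an independent U stays independent
-- in G₋W exactly when W avoids U.  Hence, after exchanging the two sums, U is
-- counted on the right with weight Σ (-1)^(|W|+1) over the non-empty W ⊆ e ∖ U,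
-- which is 1 because e ∖ U is non-empty: the edge e cannot lie inside U.
module Submission where

open import Defs
open import Data.Nat using (ℕ; suc)
open import Data.Fin using (Fin) renaming (suc to fsuc)
open import Data.Fin.Subset using (Subset; outside; inside; _⊆_; _∩_; _─_; ∁; Nonempty; Empty; ∣_∣)
  renaming (_∈_ to _∈ₛ_; _∉_ to _∉ₛ_)
open import Data.Fin.Subset.Properties
  using (_⊆?_; nonempty?; _∈?_; ⊆-trans; p─q⊆p; x∈p∧x∉q⇒x∈p─q; x∈p∩q⁺; x∈p∩q⁻; x∈∁p⇒x∉p; x∉p⇒x∈∁p)
open import Data.Vec using (_∷_; []; here; there)
open import Data.List using (List; []; _∷_; map; filter; length; foldr; _++_)
open import Data.List.Membership.Propositional using (_∈_; lose)
open import Data.List.Relation.Unary.Any using (Any)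
open import Data.List.Relation.Unary.Any.Properties using (filter⁺; filter⁻; lookup-result)
open import Data.Integer using (ℤ; +_; -_; _*_; _+_; 0ℤ; 1ℤ)
open import Data.Integer.Properties
  using (+-assoc; +-identityˡ; +-identityʳ; *-identityˡ; *-identityʳ; *-zeroʳ; *-assoc;
         *-distribˡ-+; *-distribʳ-+; neg-distrib-+; neg-distribʳ-*; neg-involutive; +-inverseʳ;
         +-commutativeSemigroup)
open import Algebra.Properties.CommutativeSemigroup +-commutativeSemigroup using (interchange)
open import Data.Bool using (Bool; true; false; _∧_; not)
open import Data.Bool.Properties using (∧-assoc)
open import Data.Empty using (⊥-elim)
open import Data.Product using (_×_; _,_; proj₁; proj₂)
open import Data.Sum using (inj₁; inj₂)
open import Function using (_∘_)
open import Function.Bundles using (_⇔_; mk⇔; Equivalence)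
open import Function.Construct.Composition using (_⇔-∘_)
open import Relation.Nullary using (Dec; yes; no; does; ¬_)
open import Relation.Nullary.Decidable using (_×-dec_; ¬?; does-≡; dec-true; dec-false; decidable-stable) renaming (map to map-dec)
open import Relation.Unary using (Decidable)
open import Relation.Binary.PropositionalEquality using (_≡_; refl; sym; trans; cong; cong₂; module ≡-Reasoning)
import Data.Nat.Properties as ℕP

open ≡-Reasoning

private
  variable
    A B : Set
    n : ℕ

∑ : List A → (A → ℤ) → ℤ
∑ []       f = 0ℤ
∑ (x ∷ xs) f = f x + ∑ xs f

∑-cong : (xs : List A) {f g : A → ℤ} → (∀ x → f x ≡ g x) → ∑ xs f ≡ ∑ xs g
∑-cong []       f≗g = refl
∑-cong (x ∷ xs) f≗g = cong₂ _+_ (f≗g x) (∑-cong xs f≗g)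

∑-zero : (xs : List A) {f : A → ℤ} → (∀ x → f x ≡ 0ℤ) → ∑ xs f ≡ 0ℤ
∑-zero []       f≗0 = refl
∑-zero (x ∷ xs) f≗0 = cong₂ _+_ (f≗0 x) (∑-zero xs f≗0)

∑-++ : (xs ys : List A) (f : A → ℤ) → ∑ (xs ++ ys) f ≡ ∑ xs f + ∑ ys f
∑-++ []       ys f = sym (+-identityˡ (∑ ys f))
∑-++ (x ∷ xs) ys f = trans (cong (_+_ (f x)) (∑-++ xs ys f)) (sym (+-assoc (f x) (∑ xs f) (∑ ys f)))

∑-map : (g : A → B) (xs : List A) (f : B → ℤ) → ∑ (map g xs) f ≡ ∑ xs (f ∘ g)
∑-map g []       f = refl
∑-map g (x ∷ xs) f = cong (_+_ (f (g x))) (∑-map g xs f)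

∑-+ : (xs : List A) (f g : A → ℤ) → ∑ xs (λ x → f x + g x) ≡ ∑ xs f + ∑ xs g
∑-+ []       f g = refl
∑-+ (x ∷ xs) f g =
  trans (cong (_+_ (f x + g x)) (∑-+ xs f g)) (interchange (f x) (g x) (∑ xs f) (∑ xs g))

∑-neg : (xs : List A) (f : A → ℤ) → ∑ xs (λ x → - f x) ≡ - ∑ xs f
∑-neg []       f = refl
∑-neg (x ∷ xs) f = trans (cong (_+_ (- f x)) (∑-neg xs f)) (sym (neg-distrib-+ (f x) (∑ xs f)))

∑-*ˡ : (c : ℤ) (xs : List A) (f : A → ℤ) → ∑ xs (λ x → c * f x) ≡ c * ∑ xs f
∑-*ˡ c []       f = sym (*-zeroʳ c)
∑-*ˡ c (x ∷ xs) f = trans (cong (_+_ (c * f x)) (∑-*ˡ c xs f)) (sym (*-distribˡ-+ c (f x) (∑ xs f)))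

∑-*ʳ : (c : ℤ) (xs : List A) (f : A → ℤ) → ∑ xs (λ x → f x * c) ≡ ∑ xs f * c
∑-*ʳ c []       f = refl
∑-*ʳ c (x ∷ xs) f = trans (cong (_+_ (f x * c)) (∑-*ʳ c xs f)) (sym (*-distribʳ-+ c (f x) (∑ xs f)))

∑-comm : (xs : List A) (ys : List B) (h : A → B → ℤ) →
  ∑ xs (λ x → ∑ ys (h x)) ≡ ∑ ys (λ y → ∑ xs (λ x → h x y))
∑-comm []       ys h = sym (∑-zero ys (λ _ → refl))
∑-comm (x ∷ xs) ys h =
  trans (cong (_+_ (∑ ys (h x))) (∑-comm xs ys h)) (sym (∑-+ ys (h x) (λ y → ∑ xs (λ x → h x y))))

⟦_⟧ : Bool → ℤ
⟦ true  ⟧ = 1ℤ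
⟦ false ⟧ = 0ℤ

𝟙 : Dec A → ℤ
𝟙 a? = ⟦ does a? ⟧

⟦∧⟧ : (a b : Bool) → ⟦ a ∧ b ⟧ ≡ ⟦ a ⟧ * ⟦ b ⟧
⟦∧⟧ true  true  = refl
⟦∧⟧ true  false = refl
⟦∧⟧ false b     = refl

⟦⟧+⟦not⟧ : (b : Bool) → ⟦ b ⟧ + ⟦ not b ⟧ ≡ 1ℤ
⟦⟧+⟦not⟧ true  = refl
⟦⟧+⟦not⟧ false = refl

⟦∧⟧-* : (a b : Bool) (s : ℤ) → ⟦ a ⟧ * s * ⟦ b ⟧ ≡ ⟦ a ∧ b ⟧ * s
⟦∧⟧-* false b     s = refl
⟦∧⟧-* true  true  s = *-identityʳ (1ℤ * s)
⟦∧⟧-* true  false s = *-zeroʳ (1ℤ * s)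

𝟙-×-dec : (a? : Dec A) (b? : Dec B) → 𝟙 (a? ×-dec b?) ≡ 𝟙 a? * 𝟙 b?
𝟙-×-dec a? b? = ⟦∧⟧ (does a?) (does b?)

does-cong : A ⇔ B → (a? : Dec A) (b? : Dec B) → does a? ≡ does b?
does-cong A⇔B a? b? = does-≡ (map-dec A⇔B a?) b?

length-filter : {P : A → Set} (P? : Decidable P) (xs : List A) →
  + length (filter P? xs) ≡ ∑ xs (𝟙 ∘ P?)
length-filter P? []       = refl
length-filter P? (x ∷ xs) with does (P? x)
... | true  = cong (_+_ 1ℤ) (length-filter P? xs)
... | false = trans (length-filter P? xs) (sym (+-identityˡ _))

∑-filter : {P : A → Set} (P? : Decidable P) (xs : List A) (f : A → ℤ) →
  ∑ (filter P? xs) f ≡ ∑ xs (λ x → 𝟙 (P? x) * f x)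
∑-filter P? []       f = refl
∑-filter P? (x ∷ xs) f with does (P? x)
... | true  = cong₂ _+_ (sym (*-identityˡ (f x))) (∑-filter P? xs f)
... | false = trans (∑-filter P? xs f) (sym (+-identityˡ _))

∑-allSubsets : (f : Subset (suc n) → ℤ) →
  ∑ (allSubsets (suc n)) f
    ≡ ∑ (allSubsets n) (f ∘ (outside ∷_)) + ∑ (allSubsets n) (f ∘ (inside ∷_))
∑-allSubsets {n} f =
  trans (∑-++ (map (outside ∷_) (allSubsets n)) _ f)
        (cong₂ _+_ (∑-map _ (allSubsets n) f) (∑-map _ (allSubsets n) f))

Nonempty-outside⇔ : {p : Subset n} → Nonempty (outside ∷ p) ⇔ Nonempty p
Nonempty-outside⇔ =
  mk⇔ (λ { (fsuc i , there i∈p) → i , i∈p }) (λ (i , i∈p) → fsuc i , there i∈p)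

nonempty?-outside : (p : Subset n) → does (nonempty? (outside ∷ p)) ≡ does (nonempty? p)
nonempty?-outside p = does-cong Nonempty-outside⇔ (nonempty? (outside ∷ p)) (nonempty? p)

⊆-∩⇔ : {p q r : Subset n} → p ⊆ q ∩ r ⇔ (p ⊆ q × p ⊆ r)
⊆-∩⇔ {p = p} {q} {r} = mk⇔ split join
  where
  split : p ⊆ q ∩ r → p ⊆ q × p ⊆ r
  split p⊆q∩r = (λ x∈p → proj₁ (x∈p∩q⁻ q r (p⊆q∩r x∈p)))
              , (λ x∈p → proj₂ (x∈p∩q⁻ q r (p⊆q∩r x∈p)))
  join : p ⊆ q × p ⊆ r → p ⊆ q ∩ r
  join (p⊆q , p⊆r) x∈p = x∈p∩q⁺ (p⊆q x∈p , p⊆r x∈p)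

x∈p─q⇒x∉q : {p q : Subset n} {x : Fin n} → x ∈ₛ p ─ q → x ∉ₛ q
x∈p─q⇒x∉q {p = _ ∷ _} {q = inside ∷ _} () here
x∈p─q⇒x∉q {p = _ ∷ p} {q = _ ∷ q} (there x∈p─q) (there x∈q) =
  x∈p─q⇒x∉q {p = p} {q} x∈p─q x∈q

Empty-∩∁⇒⊆ : {p q : Subset n} → Empty (p ∩ ∁ q) → p ⊆ q
Empty-∩∁⇒⊆ {q = q} empty {x} x∈p with x ∈? q
... | yes x∈q = x∈q
... | no  x∉q = ⊥-elim (empty (x , x∈p∩q⁺ (x∈p , x∉p⇒x∈∁p x∉q)))

-- Split on the first point: subsets containing it contribute 0 when it lies outside p,
-- and otherwise mirror the subsets omitting it with the opposite sign.
∑-sign-subsets : (p : Subset n) →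
  ∑ (allSubsets n) (λ W → 𝟙 (W ⊆? p) * signPow ∣ W ∣) ≡ 𝟙 (¬? (nonempty? p))
∑-sign-subsets [] = refl
∑-sign-subsets {suc n} (outside ∷ p) =
  trans (∑-allSubsets {n} _)
  (trans (cong₂ _+_ (∑-sign-subsets p) (∑-zero (allSubsets n) λ _ → refl))
  (trans (+-identityʳ _) (cong (⟦_⟧ ∘ not) (sym (nonempty?-outside p)))))
∑-sign-subsets {suc n} (inside ∷ p) =
  trans (∑-allSubsets {n} _)
  (trans (cong (_+_ (∑ (allSubsets n) g))
           (trans (∑-cong (allSubsets n) λ W → sym (neg-distribʳ-* (𝟙 (W ⊆? p)) (signPow ∣ W ∣)))
                  (∑-neg (allSubsets n) g)))
  (+-inverseʳ (∑ (allSubsets n) g)))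
  where
  g : Subset n → ℤ
  g W = 𝟙 (W ⊆? p) * signPow ∣ W ∣

inclExclCoeff : Subset n → Subset n → ℤ
inclExclCoeff e W = 𝟙 (nonempty? W ×-dec W ⊆? e) * signPow (suc ∣ W ∣)

inclExclCoeff-outside : (side : Bool) (p W : Subset n) →
  inclExclCoeff (side ∷ p) (outside ∷ W) ≡ inclExclCoeff p W
inclExclCoeff-outside side p W =
  cong (λ b → ⟦ b ∧ does (W ⊆? p) ⟧ * signPow (suc ∣ W ∣)) (nonempty?-outside W)

inclExclCoeff-∩ : (e q W : Subset n) → inclExclCoeff e W * 𝟙 (W ⊆? q) ≡ inclExclCoeff (e ∩ q) W
inclExclCoeff-∩ e q W = begin
  ⟦ does (nonempty? W) ∧ does (W ⊆? e) ⟧ * s * 𝟙 (W ⊆? q)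
    ≡⟨ ⟦∧⟧-* (does (nonempty? W) ∧ does (W ⊆? e)) (does (W ⊆? q)) s ⟩
  ⟦ (does (nonempty? W) ∧ does (W ⊆? e)) ∧ does (W ⊆? q) ⟧ * s
    ≡⟨ cong (λ b → ⟦ b ⟧ * s) (∧-assoc (does (nonempty? W)) _ _) ⟩
  ⟦ does (nonempty? W) ∧ (does (W ⊆? e) ∧ does (W ⊆? q)) ⟧ * s
    ≡⟨ cong (λ b → ⟦ does (nonempty? W) ∧ b ⟧ * s)
            (sym (does-cong ⊆-∩⇔ (W ⊆? e ∩ q) ((W ⊆? e) ×-dec (W ⊆? q)))) ⟩
  ⟦ does (nonempty? W) ∧ does (W ⊆? e ∩ q) ⟧ * s ∎
  where
  s : ℤ
  s = signPow (suc ∣ W ∣)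

∑-inclExclCoeff : (p : Subset n) → ∑ (allSubsets n) (inclExclCoeff p) ≡ 𝟙 (nonempty? p)
∑-inclExclCoeff [] = refl
∑-inclExclCoeff {suc n} (outside ∷ p) =
  trans (∑-allSubsets {n} _)
  (trans (cong₂ _+_ (∑-cong (allSubsets n) (inclExclCoeff-outside outside p))
                    (∑-zero (allSubsets n) λ _ → refl))
  (trans (+-identityʳ _)
  (trans (∑-inclExclCoeff p) (cong ⟦_⟧ (sym (nonempty?-outside p))))))
∑-inclExclCoeff {suc n} (inside ∷ p) =
  trans (∑-allSubsets {n} _)
  (trans (cong₂ _+_
           (trans (∑-cong (allSubsets n) (inclExclCoeff-outside inside p)) (∑-inclExclCoeff p))
           (trans (∑-cong (allSubsets n) λ W →
                    cong (𝟙 (W ⊆? p) *_) (neg-involutive (signPow ∣ W ∣)))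
                  (∑-sign-subsets p)))
  (⟦⟧+⟦not⟧ (does (nonempty? p))))

module _ (G : Hypergraph n) where

  edges-inside-survive : {U W : Subset n} → W ⊆ ∁ U →
    Any (_⊆ U) (E G) → Any (_⊆ U) (E (deleteVertices G W))
  edges-inside-survive {W = W} W⊆∁U f⊆U with filter⁺ (λ f → ¬? (nonempty? (f ∩ W))) f⊆U
  ... | inj₁ kept      = kept
  ... | inj₂ ¬¬meetsW = ⊥-elim (¬¬meetsW λ (x , x∈f∩W) →
          let x∈f , x∈W = x∈p∩q⁻ _ W x∈f∩W
          in x∈∁p⇒x∉p (W⊆∁U x∈W) (lookup-result f⊆U x∈f))

  independent-deleteVertices⇔ : (W U : Subset n) →
    Independent (deleteVertices G W) U ⇔ (Independent G U × W ⊆ ∁ U)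
  independent-deleteVertices⇔ W U = mk⇔ to from
    where
    to : Independent (deleteVertices G W) U → Independent G U × W ⊆ ∁ U
    to (U⊆V─W , no-edge) =
      (⊆-trans U⊆V─W (p─q⊆p (V G) W) , no-edge ∘ edges-inside-survive W⊆∁U) , W⊆∁U
      where
      W⊆∁U : W ⊆ ∁ U
      W⊆∁U x∈W = x∉p⇒x∈∁p (λ x∈U → x∈p─q⇒x∉q (U⊆V─W x∈U) x∈W)
    from : Independent G U × W ⊆ ∁ U → Independent (deleteVertices G W) U
    from ((U⊆V , no-edge) , W⊆∁U) =
      (λ x∈U → x∈p∧x∉q⇒x∈p─q (U⊆V x∈U) (λ x∈W → x∈∁p⇒x∉p (W⊆∁U x∈W) x∈U))
      , no-edge ∘ filter⁻ _

  edge⊈independent : {e U : Subset n} → e ∈ E G → Independent G U → ¬ e ⊆ U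
  edge⊈independent e∈E (_ , no-edge) e⊆U = no-edge (lose e∈E e⊆U)

  ∑-inclExclCoeff-deleteVertices : {e : Subset n} → e ∈ E G → (U : Subset n) →
    ∑ (allSubsets n) (λ W → inclExclCoeff e W * 𝟙 (independent? (deleteVertices G W) U))
      ≡ 𝟙 (independent? G U)
  ∑-inclExclCoeff-deleteVertices {e} e∈E U = by-independence (independent? G U)
    where
    by-independence : (iU? : Dec (Independent G U)) →
      ∑ (allSubsets n) (λ W → inclExclCoeff e W * 𝟙 (independent? (deleteVertices G W) U)) ≡ 𝟙 iU?
    by-independence (no ¬iU) = ∑-zero (allSubsets n) λ W →
      trans (cong (λ b → inclExclCoeff e W * ⟦ b ⟧)
                  (dec-false (independent? (deleteVertices G W) U) (¬iW W)))
            (*-zeroʳ (inclExclCoeff e W))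
      where
      ¬iW : ∀ W → ¬ Independent (deleteVertices G W) U
      ¬iW W = ¬iU ∘ proj₁ ∘ Equivalence.to (independent-deleteVertices⇔ W U)
    by-independence (yes iU) = begin
      ∑ (allSubsets n) (λ W → inclExclCoeff e W * 𝟙 (independent? (deleteVertices G W) U))
        ≡⟨ ∑-cong (allSubsets n) (λ W → cong (λ b → inclExclCoeff e W * ⟦ b ⟧) (avoids W)) ⟩
      ∑ (allSubsets n) (λ W → inclExclCoeff e W * 𝟙 (W ⊆? ∁ U))
        ≡⟨ ∑-cong (allSubsets n) (inclExclCoeff-∩ e (∁ U)) ⟩
      ∑ (allSubsets n) (inclExclCoeff (e ∩ ∁ U))
        ≡⟨ ∑-inclExclCoeff (e ∩ ∁ U) ⟩
      𝟙 (nonempty? (e ∩ ∁ U))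
        ≡⟨ cong ⟦_⟧ (dec-true (nonempty? (e ∩ ∁ U)) e∖U-nonempty) ⟩
      1ℤ ∎
      where
      e∖U-nonempty : Nonempty (e ∩ ∁ U)
      e∖U-nonempty = decidable-stable (nonempty? _) (edge⊈independent e∈E iU ∘ Empty-∩∁⇒⊆)
      avoids : ∀ W → does (independent? (deleteVertices G W) U) ≡ does (W ⊆? ∁ U)
      avoids W = does-cong (mk⇔ proj₂ (iU ,_) ⇔-∘ independent-deleteVertices⇔ W U)
                             (independent? (deleteVertices G W) U) (W ⊆? ∁ U)

coeff-foldr : (f : A → Poly) (xs : List A) (k : ℕ) →
  foldr (λ x acc → f x +ₚ acc) 0ₚ xs k ≡ ∑ xs (λ x → f x k)
coeff-foldr f []       k = refl
coeff-foldr f (x ∷ xs) k = cong (_+_ (f x k)) (coeff-foldr f xs k)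

indepPoly-as-∑ : (G : Hypergraph n) (k : ℕ) →
  indepPoly G k ≡ ∑ (allSubsets n) (λ U → 𝟙 (independent? G U) * 𝟙 (∣ U ∣ ℕP.≟ k))
indepPoly-as-∑ {n} G k =
  trans (length-filter _ (allSubsets n))
        (∑-cong (allSubsets n) λ U → 𝟙-×-dec (independent? G U) (∣ U ∣ ℕP.≟ k))

inclExclSum-as-∑ : (G : Hypergraph n) (e : Subset n) (k : ℕ) →
  inclExclSum G e k ≡ ∑ (allSubsets n) (λ W → inclExclCoeff e W * indepPoly (deleteVertices G W) k)
inclExclSum-as-∑ {n} G e k = begin
  inclExclSum G e k
    ≡⟨ coeff-foldr (λ W → sign W ·ₚ indepPoly (G₋ W)) (filter Q? (allSubsets n)) k ⟩
  ∑ (filter Q? (allSubsets n)) (λ W → sign W * indepPoly (G₋ W) k)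
    ≡⟨ ∑-filter Q? (allSubsets n) (λ W → sign W * indepPoly (G₋ W) k) ⟩
  ∑ (allSubsets n) (λ W → 𝟙 (Q? W) * (sign W * indepPoly (G₋ W) k))
    ≡⟨ ∑-cong (allSubsets n) (λ W → sym (*-assoc (𝟙 (Q? W)) (sign W) (indepPoly (G₋ W) k))) ⟩
  ∑ (allSubsets n) (λ W → inclExclCoeff e W * indepPoly (G₋ W) k) ∎
  where
  Q? : (W : Subset n) → Dec (Nonempty W × W ⊆ e)
  Q? W = nonempty? W ×-dec W ⊆? e
  sign : Subset n → ℤ
  sign W = signPow (suc ∣ W ∣)
  G₋ : Subset n → Hypergraph n
  G₋ = deleteVertices G

mainTheorem8 : (n : ℕ) (G : Hypergraph n) → WellFormed G → (e : Subset n) → e ∈ E G →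
    indepPoly G ≈ₚ inclExclSum G e
mainTheorem8 n G _ e e∈E k = begin
  indepPoly G k
    ≡⟨ indepPoly-as-∑ G k ⟩
  ∑ Us (λ U → 𝟙 (independent? G U) * size≡k U)
    ≡⟨ ∑-cong Us (λ U → cong (_* size≡k U) (sym (∑-inclExclCoeff-deleteVertices G e∈E U))) ⟩
  ∑ Us (λ U → ∑ Us (λ W → c W * 𝟙 (independent? (G₋ W) U)) * size≡k U)
    ≡⟨ ∑-cong Us (λ U → sym (∑-*ʳ (size≡k U) Us _)) ⟩
  ∑ Us (λ U → ∑ Us (λ W → c W * 𝟙 (independent? (G₋ W) U) * size≡k U))
    ≡⟨ ∑-comm Us Us _ ⟩
  ∑ Us (λ W → ∑ Us (λ U → c W * 𝟙 (independent? (G₋ W) U) * size≡k U))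
    ≡⟨ ∑-cong Us (λ W → trans (∑-cong Us λ U → *-assoc (c W) _ _) (∑-*ˡ (c W) Us _)) ⟩
  ∑ Us (λ W → c W * ∑ Us (λ U → 𝟙 (independent? (G₋ W) U) * size≡k U))
    ≡⟨ ∑-cong Us (λ W → cong (c W *_) (sym (indepPoly-as-∑ (G₋ W) k))) ⟩
  ∑ Us (λ W → c W * indepPoly (G₋ W) k)
    ≡⟨ sym (inclExclSum-as-∑ G e k) ⟩
  inclExclSum G e k ∎
  where
  Us : List (Subset n)
  Us = allSubsets n
  G₋ : Subset n → Hypergraph n
  G₋ = deleteVertices G
  c : Subset n → ℤ
  c = inclExclCoeff e
  size≡k : Subset n → ℤ
  size≡k U = 𝟙 (∣ U ∣ ℕP.≟ k)
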